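{- Let $x_1, x_2, x_3$ be nonzero elements of a field such that $x_1x_2x_3 = 1$, and let $d \geq 1$ be an integer. Then $$-\left(\frac{1}{x_1^d} + \frac{1}{x_2^d} + \frac{1}{x_3^d}\right) = P_d\left(x_1+x_2+x_3,\ \frac{1}{x_1}+\frac{1}{x_2}+\frac{1}{x_3}\right),$$ where $$P_d(X,Y) = d \sum_{\substack{k,l \geq 0 \\ 0 \leq 2k+3l \leq d}} (-1)^{k-1}\binom{k+l}{k}\binom{d-k-2l}{k+l}\frac{X^k Y^{d-2k-3l}}{d-k-2l} \in \mathbb{Z}[X,Y].$$ -}

module Defs where

open import Level using (Level; _⊔_)
open import Algebra.Bundles using (CommutativeRing)
open import Data.Nat as ℕ using (ℕ; zero; suc; _∸_; _≤?_)
open import Data.Nat.DivMod using (_/_)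
open import Data.Nat.Combinatorics using (_C_)
open import Data.Bool using (if_then_else_)
open import Data.Product using (_×_; ∃)
open import Relation.Nullary using (¬_)
open import Relation.Nullary.Decidable using (⌊_⌋)

module _ {c ℓ : Level} (R : CommutativeRing c ℓ) where
  open CommutativeRing R

  IsField : Set (c ⊔ ℓ)
  IsField = (¬ (1# ≈ 0#)) × (∀ x → ¬ (x ≈ 0#) → ∃ λ y → x * y ≈ 1#)

  pow : Carrier → ℕ → Carrier
  pow x zero    = 1#
  pow x (suc n) = x * pow x n

  nat· : ℕ → Carrier → Carrier
  nat· zero    x = 0#
  nat· (suc n) x = x + nat· n x

  -- (-1)^(k-1) · x   (so  -x  for k = 0)
  sgn· : ℕ → Carrier → Carrier
  sgn· zero          x = - x
  sgn· (suc zero)    x = x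
  sgn· (suc (suc k)) x = sgn· k x

  sumTo : ℕ → (ℕ → Carrier) → Carrier
  sumTo zero    f = 0#
  sumTo (suc n) f = f n + sumTo n f

  Pterm : ℕ → Carrier → Carrier → ℕ → ℕ → Carrier
  Pterm d X Y k l =
    if ⌊ 2 ℕ.* k ℕ.+ 3 ℕ.* l ≤? d ⌋
    then sgn· k (nat· (coeff (d ∸ k ∸ 2 ℕ.* l)) (pow X k * pow Y (d ∸ 2 ℕ.* k ∸ 3 ℕ.* l)))
    else 0#
    where
      -- d · C(k+l,k) · C(n,k+l) / n  with  n = d - k - 2l  (n ≥ 1 in the summation range when d ≥ 1)
      coeff : ℕ → ℕ
      coeff zero    = 0
      coeff (suc m) = (d ℕ.* ((k ℕ.+ l) C k) ℕ.* ((suc m) C (k ℕ.+ l))) / suc m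

  P : ℕ → Carrier → Carrier → Carrier
  P d X Y = sumTo (suc d) (λ k → sumTo (suc d) (λ l → Pterm d X Y k l))

{-# OPTIONS --safe #-}

-- With yᵢ = 1/xᵢ, the elementary symmetric functions of y₁, y₂, y₃ are Y = Σ yᵢ, X = Σ xᵢ
-- and 1, so by Newton's identities the power sums p_d = Σ yᵢᵈ satisfy
-- p_{d+3} = Y p_{d+2} − X p_{d+1} + p_d.
-- Put a = d − 2k − 3l. The coefficient of P_d is c(a,k,l) = (a+2k+3l)/(a+k+l) · M(a,k,l) for
-- the trinomial coefficient M, and the absorption identity a·M(a,k,l) = (a+k+l)·M(a−1,k,l)
-- (and its analogues in k and l) turns it into c = M(a−1,k,l) + 2M(a,k−1,l) + 3M(a,k,l−1).
-- As M obeys Pascal's rule M(a,k,l) = M(a−1,k,l) + M(a,k−1,l) + M(a,k,l−1), so does c in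
-- weight a+2k+3l ≥ 4. Hence W_d = Σ c(a,k,l) Y^a (−X)^k obeys the recurrence of p_d from d = 4
-- on, and the two agree for d = 1, 2, 3. Finally (−1)^(k−1) X^k = −(−X)^k turns −W_d into
-- P_d(X,Y) term by term.

module Submission where

open import Defs
open import Level using (Level)
open import Algebra.Bundles using (CommutativeRing)
open import Data.Nat as ℕ using (ℕ; zero; suc; _∸_; _≥_; _≤?_; z≤n; s≤s)
open import Data.Nat.Combinatorics using (_C_)
open import Data.Nat.DivMod using (_/_)
open import Data.Nat.Properties using (m≤n+m; m≤n⇒m≤1+n)
open import Data.Sum using (_⊎_; inj₁; inj₂)
open import Relation.Nullary using (¬_; yes; no; contradiction)
import Relation.Binary.PropositionalEquality as ≡

module Coefficients where
  open import Data.Nat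
  open import Data.Nat.Properties
  open import Data.Nat.DivMod using (_/_; m*n/n≡m)
  open import Data.Nat.Combinatorics using (_C_; nCk+nC[k+1]≡[n+1]C[k+1]; nCn≡1; nC1≡n)
  open import Data.Nat.Tactic.RingSolver using (solve-∀)
  open import Algebra.Properties.CommutativeSemigroup *-commutativeSemigroup
    using (xy∙z≈y∙xz; x∙yz≈y∙xz; xy∙z≈xz∙y)
  open import Relation.Binary.PropositionalEquality
  open ≡-Reasoning

  -- Binomial and trinomial coefficients

  C-absorb : ∀ n k → suc n * (n C k) ≡ suc k * (suc n C suc k)
  C-absorb zero    zero    = refl
  C-absorb zero    (suc k) = sym (*-zeroʳ (2 + k))
  C-absorb (suc n) zero    = trans (*-identityʳ (2 + n)) (sym (trans (+-identityʳ _) (nC1≡n (2 + n))))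
  C-absorb (suc n) (suc k) = begin
    A + suc n * A                                ≡⟨ cong (λ x → A + suc n * x) (pascal n k) ⟨
    A + suc n * (n C k + n C suc k)              ≡⟨ cong (A +_) (*-distribˡ-+ (suc n) (n C k) _) ⟩
    A + (suc n * (n C k) + suc n * (n C suc k))  ≡⟨ cong₂ (λ u v → A + (u + v))
                                                          (C-absorb n k) (C-absorb n (suc k)) ⟩
    A + (suc k * A + (2 + k) * B)                ≡⟨ +-assoc A _ _ ⟨
    (2 + k) * A + (2 + k) * B                    ≡⟨ *-distribˡ-+ (2 + k) A B ⟨
    (2 + k) * (A + B)                            ≡⟨ cong ((2 + k) *_) (pascal (suc n) (suc k)) ⟩
    (2 + k) * ((2 + n) C (2 + k))                ∎
    where
    pascal = nCk+nC[k+1]≡[n+1]C[k+1]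
    A = suc n C suc k
    B = suc n C (2 + k)

  -- (n + 1) C(n, k) = (n + 1 − k) C(n + 1, k), with n − k passed as a so that no subtraction occurs
  C-absorb-compl : ∀ {n} a k → n ≡ a + k → suc n * (n C k) ≡ suc a * (suc n C k)
  C-absorb-compl {n} a k refl = +-cancelʳ-≡ (k * (suc n C k)) _ _ (begin
      suc n * (n C k) + k * (suc n C k)      ≡⟨ sum-form n k ⟩
      suc n * (suc n C k)                    ≡⟨ split a k (suc n C k) ⟩
      suc a * (suc n C k) + k * (suc n C k)  ∎)
    where
    split : ∀ a k x → suc (a + k) * x ≡ suc a * x + k * x
    split = solve-∀
    sum-form : ∀ n k → suc n * (n C k) + k * (suc n C k) ≡ suc n * (suc n C k)
    sum-form n zero    = +-identityʳ _
    sum-form n (suc k) = begin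
      suc n * (n C suc k) + suc k * (suc n C suc k)  ≡⟨ cong (suc n * (n C suc k) +_) (C-absorb n k) ⟨
      suc n * (n C suc k) + suc n * (n C k)          ≡⟨ *-distribˡ-+ (suc n) (n C suc k) (n C k) ⟨
      suc n * (n C suc k + n C k)                    ≡⟨ cong (suc n *_) (+-comm (n C suc k) (n C k)) ⟩
      suc n * (n C k + n C suc k)                    ≡⟨ cong (suc n *_) (nCk+nC[k+1]≡[n+1]C[k+1] n k) ⟩
      suc n * (suc n C suc k)                        ∎

  Coeffs : Set
  Coeffs = ℕ → ℕ → ℕ → ℕ

  trinomial : Coeffs
  trinomial a k l = ((a + (k + l)) C (k + l)) * ((k + l) C k)

  shiftₐ shiftₖ shiftₗ : Coeffs → Coeffs
  shiftₐ f zero    k l = 0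
  shiftₐ f (suc a) k l = f a k l
  shiftₖ f a zero    l = 0
  shiftₖ f a (suc k) l = f a k l
  shiftₗ f a k zero    = 0
  shiftₗ f a k (suc l) = f a k l

  trinomial-absorbₐ : ∀ a k l → (a + (k + l)) * shiftₐ trinomial a k l ≡ a * trinomial a k l
  trinomial-absorbₐ zero    k l = *-zeroʳ (k + l)
  trinomial-absorbₐ (suc a) k l = begin
    suc (a + s) * (B * S)  ≡⟨ *-assoc (suc (a + s)) B S ⟨
    suc (a + s) * B * S    ≡⟨ cong (_* S) (C-absorb-compl a s refl) ⟩
    suc a * B′ * S         ≡⟨ *-assoc (suc a) B′ S ⟩
    suc a * (B′ * S)       ∎
    where s = k + l; S = s C k; B = (a + s) C s; B′ = suc (a + s) C s

  trinomial-absorbₖ : ∀ a k l → (a + (k + l)) * shiftₖ trinomial a k l ≡ k * trinomial a k l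
  trinomial-absorbₖ a zero    l = *-zeroʳ (a + l)
  trinomial-absorbₖ a (suc k) l rewrite +-suc a (k + l) = begin
    suc (a + t) * (B * S)           ≡⟨ *-assoc (suc (a + t)) B S ⟨
    suc (a + t) * B * S             ≡⟨ cong (_* S) (C-absorb (a + t) t) ⟩
    suc t * B′ * S                  ≡⟨ xy∙z≈y∙xz (suc t) B′ S ⟩
    B′ * (suc t * S)                ≡⟨ cong (B′ *_) (C-absorb t k) ⟩
    B′ * (suc k * (suc t C suc k))  ≡⟨ x∙yz≈y∙xz B′ (suc k) (suc t C suc k) ⟩
    suc k * (B′ * (suc t C suc k))  ∎
    where t = k + l; S = t C k; B = (a + t) C t; B′ = suc (a + t) C suc t

  trinomial-absorbₗ : ∀ a k l → (a + (k + l)) * shiftₗ trinomial a k l ≡ l * trinomial a k l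
  trinomial-absorbₗ a k zero    = *-zeroʳ (a + (k + 0))
  trinomial-absorbₗ a k (suc l) rewrite +-suc k l | +-suc a (k + l) = begin
    suc (a + t) * (B * S)       ≡⟨ *-assoc (suc (a + t)) B S ⟨
    suc (a + t) * B * S         ≡⟨ cong (_* S) (C-absorb (a + t) t) ⟩
    suc t * B′ * S              ≡⟨ xy∙z≈y∙xz (suc t) B′ S ⟩
    B′ * (suc t * S)            ≡⟨ cong (B′ *_) (C-absorb-compl l k (+-comm k l)) ⟩
    B′ * (suc l * (suc t C k))  ≡⟨ x∙yz≈y∙xz B′ (suc l) (suc t C k) ⟩
    suc l * (B′ * (suc t C k))  ∎
    where t = k + l; S = t C k; B = (a + t) C t; B′ = suc (a + t) C suc t

  Pascal : Coeffs → ℕ → ℕ → ℕ → Set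
  Pascal f a k l = f a k l ≡ shiftₐ f a k l + shiftₖ f a k l + shiftₗ f a k l

  PascalFrom : ℕ → Coeffs → Set
  PascalFrom w f = ∀ a k l → w ≤ a + 2 * k + 3 * l → Pascal f a k l

  PascalFrom-mono : ∀ {w w′ f} → w ≤ w′ → PascalFrom w f → PascalFrom w′ f
  PascalFrom-mono w≤w′ p a k l w′≤ = p a k l (≤-trans w≤w′ w′≤)

  trinomial-shiftₖ+shiftₗ : ∀ a k l t → k + l ≡ suc t →
    shiftₖ trinomial a k l + shiftₗ trinomial a k l ≡ ((a + t) C t) * ((k + l) C k)
  trinomial-shiftₖ+shiftₗ a zero    (suc l) .l           refl = refl
  trinomial-shiftₖ+shiftₗ a (suc k) zero    .(k + 0)     refl rewrite +-identityʳ k =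
    trans (+-identityʳ _) (cong (((a + k) C k) *_) (trans (nCn≡1 k) (sym (nCn≡1 (suc k)))))
  trinomial-shiftₖ+shiftₗ a (suc k) (suc l) .(k + suc l) refl rewrite +-suc k l = begin
    B * (suc t C k) + B * (suc t C suc k)  ≡⟨ *-distribˡ-+ B (suc t C k) (suc t C suc k) ⟨
    B * (suc t C k + suc t C suc k)        ≡⟨ cong (B *_) (nCk+nC[k+1]≡[n+1]C[k+1] (suc t) k) ⟩
    B * (suc (suc t) C suc k)              ∎
    where t = k + l; B = (a + suc t) C suc t

  trinomial-pascal-k+l≡suc : ∀ a k l t → k + l ≡ suc t → Pascal trinomial a k l
  trinomial-pascal-k+l≡suc zero k l t eq = begin
    ((k + l) C (k + l)) * S  ≡⟨ cong (_* S) (trans (nCn≡1 (k + l)) (sym (nCn≡1 t))) ⟩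
    (t C t) * S              ≡⟨ trinomial-shiftₖ+shiftₗ zero k l t eq ⟨
    shiftₖ trinomial 0 k l + shiftₗ trinomial 0 k l ∎
    where S = (k + l) C k
  trinomial-pascal-k+l≡suc (suc a) k l t eq = begin
    ((suc a + s) C s) * S                        ≡⟨ cong (λ s → ((suc a + s) C s) * S) eq ⟩
    (suc (a + suc t) C suc t) * S                ≡⟨ cong (_* S) (nCk+nC[k+1]≡[n+1]C[k+1] (a + suc t) t) ⟨
    ((a + suc t) C t + (a + suc t) C suc t) * S  ≡⟨ *-distribʳ-+ S ((a + suc t) C t) _ ⟩
    ((a + suc t) C t) * S + ((a + suc t) C suc t) * S
      ≡⟨ cong₂ _+_ (cong (λ n → (n C t) * S) (+-suc a t)) (cong (λ s → ((a + s) C s) * S) (sym eq)) ⟩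
    ((suc a + t) C t) * S + M                    ≡⟨ +-comm _ M ⟩
    M + ((suc a + t) C t) * S                    ≡⟨ cong (M +_) (trinomial-shiftₖ+shiftₗ (suc a) k l t eq) ⟨
    M + (shiftₖ trinomial (suc a) k l + shiftₗ trinomial (suc a) k l)  ≡⟨ +-assoc M _ _ ⟨
    M + shiftₖ trinomial (suc a) k l + shiftₗ trinomial (suc a) k l    ∎
    where s = k + l; S = s C k; M = trinomial a k l

  trinomial-pascal : PascalFrom 1 trinomial
  trinomial-pascal zero    zero    zero    ()
  trinomial-pascal (suc a) zero    zero    _ = refl
  trinomial-pascal a       zero    (suc l) _ = trinomial-pascal-k+l≡suc a zero (suc l) l refl
  trinomial-pascal a       (suc k) l       _ = trinomial-pascal-k+l≡suc a (suc k) l (k + l) refl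

  shiftₐ-shiftₖ : ∀ f a k l → shiftₐ (shiftₖ f) a k l ≡ shiftₖ (shiftₐ f) a k l
  shiftₐ-shiftₖ f zero    zero    l = refl
  shiftₐ-shiftₖ f zero    (suc k) l = refl
  shiftₐ-shiftₖ f (suc a) zero    l = refl
  shiftₐ-shiftₖ f (suc a) (suc k) l = refl

  shiftₐ-shiftₗ : ∀ f a k l → shiftₐ (shiftₗ f) a k l ≡ shiftₗ (shiftₐ f) a k l
  shiftₐ-shiftₗ f zero    k zero    = refl
  shiftₐ-shiftₗ f zero    k (suc l) = refl
  shiftₐ-shiftₗ f (suc a) k zero    = refl
  shiftₐ-shiftₗ f (suc a) k (suc l) = refl

  shiftₖ-shiftₗ : ∀ f a k l → shiftₖ (shiftₗ f) a k l ≡ shiftₗ (shiftₖ f) a k l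
  shiftₖ-shiftₗ f a zero    zero    = refl
  shiftₖ-shiftₗ f a zero    (suc l) = refl
  shiftₖ-shiftₗ f a (suc k) zero    = refl
  shiftₖ-shiftₗ f a (suc k) (suc l) = refl

  weight-sucₖ : ∀ a k l → a + 2 * suc k + 3 * l ≡ 2 + (a + 2 * k + 3 * l)
  weight-sucₖ = solve-∀

  weight-sucₗ : ∀ a k l → a + 2 * k + 3 * suc l ≡ 3 + (a + 2 * k + 3 * l)
  weight-sucₗ = solve-∀

  shiftₐ-pascal : ∀ {w f} → PascalFrom w f → PascalFrom (1 + w) (shiftₐ f)
  shiftₐ-pascal {w} {f} p a k l w≤ = begin
    shiftₐ f a k l
      ≡⟨ shifted a w≤ ⟩
    shiftₐ (shiftₐ f) a k l + shiftₐ (shiftₖ f) a k l + shiftₐ (shiftₗ f) a k l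
      ≡⟨ cong₂ (λ u v → shiftₐ (shiftₐ f) a k l + u + v)
               (shiftₐ-shiftₖ f a k l) (shiftₐ-shiftₗ f a k l) ⟩
    shiftₐ (shiftₐ f) a k l + shiftₖ (shiftₐ f) a k l + shiftₗ (shiftₐ f) a k l
      ∎
    where
    shifted : ∀ a → 1 + w ≤ a + 2 * k + 3 * l →
      shiftₐ f a k l ≡ shiftₐ (shiftₐ f) a k l + shiftₐ (shiftₖ f) a k l + shiftₐ (shiftₗ f) a k l
    shifted zero    _  = refl
    shifted (suc a) w≤ = p a k l (≤-pred w≤)

  shiftₖ-pascal : ∀ {w f} → PascalFrom w f → PascalFrom (2 + w) (shiftₖ f)
  shiftₖ-pascal {w} {f} p a k l w≤ = begin
    shiftₖ f a k l
      ≡⟨ shifted k w≤ ⟩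
    shiftₖ (shiftₐ f) a k l + shiftₖ (shiftₖ f) a k l + shiftₖ (shiftₗ f) a k l
      ≡⟨ cong₂ (λ u v → u + shiftₖ (shiftₖ f) a k l + v)
               (sym (shiftₐ-shiftₖ f a k l)) (shiftₖ-shiftₗ f a k l) ⟩
    shiftₐ (shiftₖ f) a k l + shiftₖ (shiftₖ f) a k l + shiftₗ (shiftₖ f) a k l
      ∎
    where
    shifted : ∀ k → 2 + w ≤ a + 2 * k + 3 * l →
      shiftₖ f a k l ≡ shiftₖ (shiftₐ f) a k l + shiftₖ (shiftₖ f) a k l + shiftₖ (shiftₗ f) a k l
    shifted zero    _  = refl
    shifted (suc k) w≤ = p a k l (+-cancelˡ-≤ 2 _ _ (subst (2 + w ≤_) (weight-sucₖ a k l) w≤))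

  shiftₗ-pascal : ∀ {w f} → PascalFrom w f → PascalFrom (3 + w) (shiftₗ f)
  shiftₗ-pascal {w} {f} p a k l w≤ = begin
    shiftₗ f a k l
      ≡⟨ shifted l w≤ ⟩
    shiftₗ (shiftₐ f) a k l + shiftₗ (shiftₖ f) a k l + shiftₗ (shiftₗ f) a k l
      ≡⟨ cong₂ (λ u v → u + v + shiftₗ (shiftₗ f) a k l)
               (shiftₐ-shiftₗ f a k l) (shiftₖ-shiftₗ f a k l) ⟨
    shiftₐ (shiftₗ f) a k l + shiftₖ (shiftₗ f) a k l + shiftₗ (shiftₗ f) a k l
      ∎
    where
    shifted : ∀ l → 3 + w ≤ a + 2 * k + 3 * l →
      shiftₗ f a k l ≡ shiftₗ (shiftₐ f) a k l + shiftₗ (shiftₖ f) a k l + shiftₗ (shiftₗ f) a k l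
    shifted zero    _  = refl
    shifted (suc l) w≤ = p a k l (+-cancelˡ-≤ 3 _ _ (subst (3 + w ≤_) (weight-sucₗ a k l) w≤))

  weighted : Coeffs → Coeffs → Coeffs → Coeffs
  weighted f g h a k l = f a k l + 2 * g a k l + 3 * h a k l

  shiftₐ-weighted : ∀ f g h a k l →
    shiftₐ (weighted f g h) a k l ≡ weighted (shiftₐ f) (shiftₐ g) (shiftₐ h) a k l
  shiftₐ-weighted f g h zero    k l = refl
  shiftₐ-weighted f g h (suc a) k l = refl

  shiftₖ-weighted : ∀ f g h a k l →
    shiftₖ (weighted f g h) a k l ≡ weighted (shiftₖ f) (shiftₖ g) (shiftₖ h) a k l
  shiftₖ-weighted f g h a zero    l = refl
  shiftₖ-weighted f g h a (suc k) l = refl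

  shiftₗ-weighted : ∀ f g h a k l →
    shiftₗ (weighted f g h) a k l ≡ weighted (shiftₗ f) (shiftₗ g) (shiftₗ h) a k l
  shiftₗ-weighted f g h a k zero    = refl
  shiftₗ-weighted f g h a k (suc l) = refl

  weighted-pascal : ∀ {w f g h} →
    PascalFrom w f → PascalFrom w g → PascalFrom w h → PascalFrom w (weighted f g h)
  weighted-pascal {f = f} {g} {h} pf pg ph a k l w≤ = begin
    weighted f g h a k l
      ≡⟨ cong₂ (λ u v → u + 2 * v + 3 * h a k l) (pf a k l w≤) (pg a k l w≤) ⟩
    Σ f + 2 * Σ g + 3 * h a k l
      ≡⟨ cong (λ u → Σ f + 2 * Σ g + 3 * u) (ph a k l w≤) ⟩
    Σ f + 2 * Σ g + 3 * Σ h
      ≡⟨ regroup (shiftₐ f a k l) (shiftₖ f a k l) (shiftₗ f a k l)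
                 (shiftₐ g a k l) (shiftₖ g a k l) (shiftₗ g a k l)
                 (shiftₐ h a k l) (shiftₖ h a k l) (shiftₗ h a k l) ⟩
    weighted (shiftₐ f) (shiftₐ g) (shiftₐ h) a k l + weighted (shiftₖ f) (shiftₖ g) (shiftₖ h) a k l
      + weighted (shiftₗ f) (shiftₗ g) (shiftₗ h) a k l
      ≡⟨ cong₂ _+_ (cong₂ _+_ (shiftₐ-weighted f g h a k l) (shiftₖ-weighted f g h a k l))
                   (shiftₗ-weighted f g h a k l) ⟨
    shiftₐ (weighted f g h) a k l + shiftₖ (weighted f g h) a k l + shiftₗ (weighted f g h) a k l
      ∎
    where
    Σ : Coeffs → ℕ
    Σ f = shiftₐ f a k l + shiftₖ f a k l + shiftₗ f a k l
    regroup : ∀ fa fk fl ga gk gl ha hk hl →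
      (fa + fk + fl) + 2 * (ga + gk + gl) + 3 * (ha + hk + hl) ≡
      (fa + 2 * ga + 3 * ha) + (fk + 2 * gk + 3 * hk) + (fl + 2 * gl + 3 * hl)
    regroup = solve-∀

  waringCoeff : Coeffs
  waringCoeff = weighted (shiftₐ trinomial) (shiftₖ trinomial) (shiftₗ trinomial)

  waringCoeff-spec : ∀ a k l → (a + (k + l)) * waringCoeff a k l ≡ (a + 2 * k + 3 * l) * trinomial a k l
  waringCoeff-spec a k l = begin
    n * (A + 2 * K + 3 * L)            ≡⟨ distrib n A K L ⟩
    n * A + 2 * (n * K) + 3 * (n * L)  ≡⟨ cong₂ (λ u v → u + 2 * v + 3 * (n * L))
                                                (trinomial-absorbₐ a k l) (trinomial-absorbₖ a k l) ⟩
    a * M + 2 * (k * M) + 3 * (n * L)  ≡⟨ cong (λ u → a * M + 2 * (k * M) + 3 * u)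
                                               (trinomial-absorbₗ a k l) ⟩
    a * M + 2 * (k * M) + 3 * (l * M)  ≡⟨ collect a k l M ⟩
    (a + 2 * k + 3 * l) * M            ∎
    where
    n = a + (k + l); M = trinomial a k l
    A = shiftₐ trinomial a k l; K = shiftₖ trinomial a k l; L = shiftₗ trinomial a k l
    distrib : ∀ n x y z → n * (x + 2 * y + 3 * z) ≡ n * x + 2 * (n * y) + 3 * (n * z)
    distrib = solve-∀
    collect : ∀ a k l m → a * m + 2 * (k * m) + 3 * (l * m) ≡ (a + 2 * k + 3 * l) * m
    collect = solve-∀

  waringCoeff-pascal : PascalFrom 4 waringCoeff
  waringCoeff-pascal = weighted-pascal
    (PascalFrom-mono (s≤s (s≤s z≤n)) (shiftₐ-pascal trinomial-pascal))
    (PascalFrom-mono (s≤s (s≤s (s≤s z≤n))) (shiftₖ-pascal trinomial-pascal))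
    (shiftₗ-pascal trinomial-pascal)

  -- d ∸ 2k ∸ 3l is the exponent a of Y in the (k, l) term of degree d.
  residue-split : ∀ d k l → 2 * k + 3 * l ≤ d → d ≡ (d ∸ 2 * k ∸ 3 * l) + 2 * k + 3 * l
  residue-split d k l w≤d = begin
    d                                      ≡⟨ m∸n+n≡m w≤d ⟨
    d ∸ (2 * k + 3 * l) + (2 * k + 3 * l)  ≡⟨ cong (_+ (2 * k + 3 * l)) (∸-+-assoc d (2 * k) (3 * l)) ⟨
    d ∸ 2 * k ∸ 3 * l + (2 * k + 3 * l)    ≡⟨ +-assoc (d ∸ 2 * k ∸ 3 * l) (2 * k) (3 * l) ⟨
    d ∸ 2 * k ∸ 3 * l + 2 * k + 3 * l      ∎

  residue-suc : ∀ d k l → 2 * k + 3 * l ≤ d → suc d ∸ 2 * k ∸ 3 * l ≡ suc (d ∸ 2 * k ∸ 3 * l)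
  residue-suc d k l w≤d = begin
    suc d ∸ 2 * k ∸ 3 * l      ≡⟨ ∸-+-assoc (suc d) (2 * k) (3 * l) ⟩
    suc d ∸ (2 * k + 3 * l)    ≡⟨ +-∸-assoc 1 w≤d ⟩
    suc (d ∸ (2 * k + 3 * l))  ≡⟨ cong suc (∸-+-assoc d (2 * k) (3 * l)) ⟨
    suc (d ∸ 2 * k ∸ 3 * l)    ∎

  residue-suc-≰ : ∀ d k l → 2 * k + 3 * l ≰ d → suc d ∸ 2 * k ∸ 3 * l ≡ 0
  residue-suc-≰ d k l w≰d = trans (∸-+-assoc (suc d) (2 * k) (3 * l)) (m≤n⇒m∸n≡0 (≰⇒> w≰d))

  weight₂₃-sucₖ : ∀ k l → 2 * suc k + 3 * l ≡ 2 + (2 * k + 3 * l)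
  weight₂₃-sucₖ = solve-∀

  weight₂₃-sucₗ : ∀ k l → 2 * k + 3 * suc l ≡ 3 + (2 * k + 3 * l)
  weight₂₃-sucₗ = solve-∀

  residue-sucₖ : ∀ d k l → 2 + d ∸ 2 * suc k ∸ 3 * l ≡ d ∸ 2 * k ∸ 3 * l
  residue-sucₖ d k l = begin
    2 + d ∸ 2 * suc k ∸ 3 * l    ≡⟨ ∸-+-assoc (2 + d) (2 * suc k) (3 * l) ⟩
    2 + d ∸ (2 * suc k + 3 * l)  ≡⟨ cong (2 + d ∸_) (weight₂₃-sucₖ k l) ⟩
    d ∸ (2 * k + 3 * l)          ≡⟨ ∸-+-assoc d (2 * k) (3 * l) ⟨
    d ∸ 2 * k ∸ 3 * l            ∎

  residue-sucₗ : ∀ d k l → 3 + d ∸ 2 * k ∸ 3 * suc l ≡ d ∸ 2 * k ∸ 3 * l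
  residue-sucₗ d k l = begin
    3 + d ∸ 2 * k ∸ 3 * suc l    ≡⟨ ∸-+-assoc (3 + d) (2 * k) (3 * suc l) ⟩
    3 + d ∸ (2 * k + 3 * suc l)  ≡⟨ cong (3 + d ∸_) (weight₂₃-sucₗ k l) ⟩
    d ∸ (2 * k + 3 * l)          ≡⟨ ∸-+-assoc d (2 * k) (3 * l) ⟨
    d ∸ 2 * k ∸ 3 * l            ∎

  ≤-sucₖ : ∀ d k l → 2 * suc k + 3 * l ≤ 2 + d → 2 * k + 3 * l ≤ d
  ≤-sucₖ d k l w≤ = +-cancelˡ-≤ 2 _ _ (subst (_≤ 2 + d) (weight₂₃-sucₖ k l) w≤)

  ≤-sucₗ : ∀ d k l → 2 * k + 3 * suc l ≤ 3 + d → 2 * k + 3 * l ≤ d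
  ≤-sucₗ d k l w≤ = +-cancelˡ-≤ 3 _ _ (subst (_≤ 3 + d) (weight₂₃-sucₗ k l) w≤)

  sucₖ-≤ : ∀ d k l → 2 * k + 3 * l ≤ d → 2 * suc k + 3 * l ≤ 2 + d
  sucₖ-≤ d k l w≤ = subst (_≤ 2 + d) (sym (weight₂₃-sucₖ k l)) (+-monoʳ-≤ 2 w≤)

  sucₗ-≤ : ∀ d k l → 2 * k + 3 * l ≤ d → 2 * k + 3 * suc l ≤ 3 + d
  sucₗ-≤ d k l w≤ = subst (_≤ 3 + d) (sym (weight₂₃-sucₗ k l)) (+-monoʳ-≤ 3 w≤)

  <ₖ⇒≰ : ∀ d k l → d < k → 2 * k + 3 * l ≰ d
  <ₖ⇒≰ d k l d<k w≤d = <⇒≱ d<k (≤-trans (m≤m+n k (k + 3 * l)) (subst (_≤ d) (shape k l) w≤d))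
    where
    shape : ∀ k l → 2 * k + 3 * l ≡ k + (k + 3 * l)
    shape = solve-∀

  <ₗ⇒≰ : ∀ d k l → d < l → 2 * k + 3 * l ≰ d
  <ₗ⇒≰ d k l d<l w≤d = <⇒≱ d<l (≤-trans (m≤m+n l (2 * k + 2 * l)) (subst (_≤ d) (shape k l) w≤d))
    where
    shape : ∀ k l → 2 * k + 3 * l ≡ l + (2 * k + 2 * l)
    shape = solve-∀

  residue-k+l : ∀ d a k l → d ≡ a + 2 * k + 3 * l → d ∸ k ∸ 2 * l ≡ a + (k + l)
  residue-k+l _ a k l refl = begin
    a + 2 * k + 3 * l ∸ k ∸ 2 * l            ≡⟨ ∸-+-assoc (a + 2 * k + 3 * l) k (2 * l) ⟩
    a + 2 * k + 3 * l ∸ (k + 2 * l)          ≡⟨ cong (_∸ (k + 2 * l)) (shape a k l) ⟩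
    a + (k + l) + (k + 2 * l) ∸ (k + 2 * l)  ≡⟨ m+n∸n≡m (a + (k + l)) (k + 2 * l) ⟩
    a + (k + l)                              ∎
    where
    shape : ∀ a k l → a + 2 * k + 3 * l ≡ a + (k + l) + (k + 2 * l)
    shape = solve-∀

  size-zero⇒weight-zero : ∀ a k l → a + (k + l) ≡ 0 → a + 2 * k + 3 * l ≡ 0
  size-zero⇒weight-zero zero zero zero _ = refl

  waringCoeff-quotient : ∀ d a k l m → d ≡ a + 2 * k + 3 * l → suc m ≡ a + (k + l) →
    (d * ((k + l) C k) * (suc m C (k + l))) / suc m ≡ waringCoeff a k l
  waringCoeff-quotient d a k l m d≡ n≡ = begin
    d * ((k + l) C k) * (suc m C (k + l)) / suc m  ≡⟨ cong (_/ suc m) numerator ⟩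
    waringCoeff a k l * suc m / suc m               ≡⟨ m*n/n≡m (waringCoeff a k l) (suc m) ⟩
    waringCoeff a k l                               ∎
    where
    numerator : d * ((k + l) C k) * (suc m C (k + l)) ≡ waringCoeff a k l * suc m
    numerator = begin
      d * ((k + l) C k) * (suc m C (k + l))      ≡⟨ xy∙z≈xz∙y d _ _ ⟩
      d * (suc m C (k + l)) * ((k + l) C k)      ≡⟨ *-assoc d _ _ ⟩
      d * ((suc m C (k + l)) * ((k + l) C k))    ≡⟨ cong₂ (λ d n → d * ((n C (k + l)) * ((k + l) C k)))
                                                          d≡ n≡ ⟩
      (a + 2 * k + 3 * l) * trinomial a k l      ≡⟨ waringCoeff-spec a k l ⟨
      (a + (k + l)) * waringCoeff a k l          ≡⟨ cong (_* waringCoeff a k l) n≡ ⟨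
      suc m * waringCoeff a k l                  ≡⟨ *-comm (suc m) _ ⟩
      waringCoeff a k l * suc m                  ∎

open Coefficients

module _ {c ℓ : Level} (F : CommutativeRing c ℓ) where
  open CommutativeRing F
  open import Algebra.Properties.Ring ring
    using (-0#≈0#; -‿+-comm; -‿distribˡ-*; -‿distribʳ-*; -‿involutive)
  import Algebra.Properties.CommutativeSemigroup +-commutativeSemigroup as +-CS
  import Algebra.Properties.CommutativeSemigroup *-commutativeSemigroup as *-CS
  open import Algebra.Solver.Ring.NaturalCoefficients.Default commutativeSemiring
  open import Relation.Binary.Reasoning.Setoid setoid

  -- Finite sums

  sumTo-cong : ∀ n {f g : ℕ → Carrier} → (∀ i → f i ≈ g i) → sumTo F n f ≈ sumTo F n g
  sumTo-cong zero    f≈g = refl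
  sumTo-cong (suc n) f≈g = +-cong (f≈g n) (sumTo-cong n f≈g)

  sumTo-zero : ∀ n {f : ℕ → Carrier} → (∀ i → f i ≈ 0#) → sumTo F n f ≈ 0#
  sumTo-zero zero    f≈0 = refl
  sumTo-zero (suc n) f≈0 = trans (+-cong (f≈0 n) (sumTo-zero n f≈0)) (+-identityʳ 0#)

  sumTo-+ : ∀ n (f g : ℕ → Carrier) → sumTo F n (λ i → f i + g i) ≈ sumTo F n f + sumTo F n g
  sumTo-+ zero    f g = sym (+-identityʳ 0#)
  sumTo-+ (suc n) f g = trans (+-congˡ (sumTo-+ n f g)) (+-CS.interchange (f n) (g n) _ _)

  sumTo-*ˡ : ∀ n a (f : ℕ → Carrier) → a * sumTo F n f ≈ sumTo F n (λ i → a * f i)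
  sumTo-*ˡ zero    a f = zeroʳ a
  sumTo-*ˡ (suc n) a f = trans (distribˡ a (f n) _) (+-congˡ (sumTo-*ˡ n a f))

  sumTo-neg : ∀ n (f : ℕ → Carrier) → - sumTo F n f ≈ sumTo F n (λ i → - f i)
  sumTo-neg zero    f = -0#≈0#
  sumTo-neg (suc n) f = trans (sym (-‿+-comm (f n) _)) (+-congˡ (sumTo-neg n f))

  sumTo-suc : ∀ n (f : ℕ → Carrier) → sumTo F (suc n) f ≈ sumTo F n (λ i → f (suc i)) + f 0
  sumTo-suc zero    f = +-comm (f 0) 0#
  sumTo-suc (suc n) f = trans (+-congˡ (sumTo-suc n f)) (sym (+-assoc (f (suc n)) _ _))

  sumTo-pad : ∀ m n (f : ℕ → Carrier) → (∀ i → n ℕ.≤ i → f i ≈ 0#) →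
    sumTo F (m ℕ.+ n) f ≈ sumTo F n f
  sumTo-pad zero    n f f≈0 = refl
  sumTo-pad (suc m) n f f≈0 =
    trans (+-cong (f≈0 (m ℕ.+ n) (m≤n+m n m)) (sumTo-pad m n f f≈0)) (+-identityˡ _)

  sumTo² : ℕ → ℕ → (ℕ → ℕ → Carrier) → Carrier
  sumTo² m n f = sumTo F m (λ k → sumTo F n (f k))

  sumTo²-cong : ∀ m n {f g : ℕ → ℕ → Carrier} → (∀ k l → f k l ≈ g k l) →
    sumTo² m n f ≈ sumTo² m n g
  sumTo²-cong m n f≈g = sumTo-cong m (λ k → sumTo-cong n (f≈g k))

  sumTo²-+ : ∀ m n (f g : ℕ → ℕ → Carrier) →
    sumTo² m n (λ k l → f k l + g k l) ≈ sumTo² m n f + sumTo² m n g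
  sumTo²-+ m n f g = trans (sumTo-cong m (λ k → sumTo-+ n (f k) (g k))) (sumTo-+ m _ _)

  sumTo²-*ˡ : ∀ m n a (f : ℕ → ℕ → Carrier) → a * sumTo² m n f ≈ sumTo² m n (λ k l → a * f k l)
  sumTo²-*ˡ m n a f = trans (sumTo-*ˡ m a _) (sumTo-cong m (λ k → sumTo-*ˡ n a (f k)))

  sumTo²-neg : ∀ m n (f : ℕ → ℕ → Carrier) → - sumTo² m n f ≈ sumTo² m n (λ k l → - f k l)
  sumTo²-neg m n f = trans (sumTo-neg m _) (sumTo-cong m (λ k → sumTo-neg n (f k)))

  sumTo²-dropRow : ∀ m n (f : ℕ → ℕ → Carrier) → (∀ l → f 0 l ≈ 0#) →
    sumTo² (suc m) n f ≈ sumTo² m n (λ k → f (suc k))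
  sumTo²-dropRow m n f f₀≈0 =
    trans (sumTo-suc m _) (trans (+-congˡ (sumTo-zero n f₀≈0)) (+-identityʳ _))

  sumTo²-dropColumn : ∀ m n (f : ℕ → ℕ → Carrier) → (∀ k → f k 0 ≈ 0#) →
    sumTo² m (suc n) f ≈ sumTo² m n (λ k l → f k (suc l))
  sumTo²-dropColumn m n f f₀≈0 =
    sumTo-cong m (λ k → trans (sumTo-suc n (f k)) (trans (+-congˡ (f₀≈0 k)) (+-identityʳ _)))

  sumTo²-pad : ∀ m₁ m₂ n (f : ℕ → ℕ → Carrier) →
    (∀ k l → n ℕ.≤ k ⊎ n ℕ.≤ l → f k l ≈ 0#) → sumTo² (m₁ ℕ.+ n) (m₂ ℕ.+ n) f ≈ sumTo² n n f
  sumTo²-pad m₁ m₂ n f f≈0 = trans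
    (sumTo-pad m₁ n _ (λ k n≤k → sumTo-zero (m₂ ℕ.+ n) (λ l → f≈0 k l (inj₁ n≤k))))
    (sumTo-cong n (λ k → sumTo-pad m₂ n (f k) (λ l n≤l → f≈0 k l (inj₂ n≤l))))

  nat·-cong : ∀ n {x y} → x ≈ y → nat· F n x ≈ nat· F n y
  nat·-cong zero    x≈y = refl
  nat·-cong (suc n) x≈y = +-cong x≈y (nat·-cong n x≈y)

  nat·-+ : ∀ m n x → nat· F (m ℕ.+ n) x ≈ nat· F m x + nat· F n x
  nat·-+ zero    n x = sym (+-identityˡ _)
  nat·-+ (suc m) n x = trans (+-congˡ (nat·-+ m n x)) (sym (+-assoc x _ _))

  nat·-*ˡ : ∀ n x y → nat· F n (x * y) ≈ x * nat· F n y
  nat·-*ˡ zero    x y = sym (zeroʳ x)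
  nat·-*ˡ (suc n) x y = trans (+-congˡ (nat·-*ˡ n x y)) (sym (distribˡ x y _))

  -- Girard–Waring sums

  module WaringSum (Y Z : Carrier) where

    term : Coeffs → ℕ → ℕ → ℕ → Carrier
    term c d k l with 2 ℕ.* k ℕ.+ 3 ℕ.* l ≤? d
    ... | yes _ = nat· F (c (d ∸ 2 ℕ.* k ∸ 3 ℕ.* l) k l)
                         (pow F Z k * pow F Y (d ∸ 2 ℕ.* k ∸ 3 ℕ.* l))
    ... | no  _ = 0#

    waringSum : Coeffs → ℕ → Carrier
    waringSum c d = sumTo² (suc d) (suc d) (term c d)

    term-≰ : ∀ c d k l → ¬ (2 ℕ.* k ℕ.+ 3 ℕ.* l ℕ.≤ d) → term c d k l ≈ 0#
    term-≰ c d k l w≰d with 2 ℕ.* k ℕ.+ 3 ℕ.* l ≤? d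
    ... | yes w≤d = contradiction w≤d w≰d
    ... | no  _   = refl

    waringSum-pad : ∀ c d m₁ m₂ → sumTo² (m₁ ℕ.+ suc d) (m₂ ℕ.+ suc d) (term c d) ≈ waringSum c d
    waringSum-pad c d m₁ m₂ = sumTo²-pad m₁ m₂ (suc d) (term c d) outside
      where
      outside : ∀ k l → d ℕ.< k ⊎ d ℕ.< l → term c d k l ≈ 0#
      outside k l (inj₁ d<k) = term-≰ c d k l (<ₖ⇒≰ d k l d<k)
      outside k l (inj₂ d<l) = term-≰ c d k l (<ₗ⇒≰ d k l d<l)

    term-shiftₐ : ∀ c d k l → term (shiftₐ c) (suc d) k l ≈ Y * term c d k l
    term-shiftₐ c d k l with 2 ℕ.* k ℕ.+ 3 ℕ.* l ≤? suc d | 2 ℕ.* k ℕ.+ 3 ℕ.* l ≤? d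
    ... | yes _  | yes w≤d rewrite residue-suc d k l w≤d =
      trans (nat·-cong n (*-CS.x∙yz≈y∙xz (pow F Z k) Y _)) (nat·-*ˡ n Y _)
      where n = c (d ∸ 2 ℕ.* k ∸ 3 ℕ.* l) k l
    ... | yes _  | no  w≰d rewrite residue-suc-≰ d k l w≰d = sym (zeroʳ Y)
    ... | no  w≰ | yes w≤d = contradiction (m≤n⇒m≤1+n w≤d) w≰
    ... | no  _  | no  _   = sym (zeroʳ Y)

    waringSum-shiftₐ : ∀ c d → waringSum (shiftₐ c) (suc d) ≈ Y * waringSum c d
    waringSum-shiftₐ c d = begin
      waringSum (shiftₐ c) (suc d)
        ≈⟨ sumTo²-cong (2 ℕ.+ d) (2 ℕ.+ d) (term-shiftₐ c d) ⟩
      sumTo² (2 ℕ.+ d) (2 ℕ.+ d) (λ k l → Y * term c d k l)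
        ≈⟨ sumTo²-*ˡ (2 ℕ.+ d) (2 ℕ.+ d) Y (term c d) ⟨
      Y * sumTo² (2 ℕ.+ d) (2 ℕ.+ d) (term c d)
        ≈⟨ *-congˡ (waringSum-pad c d 1 1) ⟩
      Y * waringSum c d
        ∎

    term-shiftₖ-zero : ∀ c d l → term (shiftₖ c) d 0 l ≈ 0#
    term-shiftₖ-zero c d l with 2 ℕ.* 0 ℕ.+ 3 ℕ.* l ≤? d
    ... | yes _ = refl
    ... | no  _ = refl

    term-shiftₖ : ∀ c d k l → term (shiftₖ c) (suc (suc d)) (suc k) l ≈ Z * term c d k l
    term-shiftₖ c d k l with 2 ℕ.* suc k ℕ.+ 3 ℕ.* l ≤? suc (suc d) | 2 ℕ.* k ℕ.+ 3 ℕ.* l ≤? d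
    ... | yes _  | yes _   rewrite residue-sucₖ d k l =
      trans (nat·-cong n (*-assoc Z (pow F Z k) _)) (nat·-*ˡ n Z _)
      where n = c (d ∸ 2 ℕ.* k ∸ 3 ℕ.* l) k l
    ... | yes w≤ | no  w≰d = contradiction (≤-sucₖ d k l w≤) w≰d
    ... | no  w≰ | yes w≤d = contradiction (sucₖ-≤ d k l w≤d) w≰
    ... | no  _  | no  _   = sym (zeroʳ Z)

    waringSum-shiftₖ : ∀ c d → waringSum (shiftₖ c) (2 ℕ.+ d) ≈ Z * waringSum c d
    waringSum-shiftₖ c d = begin
      waringSum (shiftₖ c) (2 ℕ.+ d)
        ≈⟨ sumTo²-dropRow (2 ℕ.+ d) (3 ℕ.+ d) _ (term-shiftₖ-zero c (2 ℕ.+ d)) ⟩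
      sumTo² (2 ℕ.+ d) (3 ℕ.+ d) (λ k → term (shiftₖ c) (2 ℕ.+ d) (suc k))
        ≈⟨ sumTo²-cong (2 ℕ.+ d) (3 ℕ.+ d) (term-shiftₖ c d) ⟩
      sumTo² (2 ℕ.+ d) (3 ℕ.+ d) (λ k l → Z * term c d k l)
        ≈⟨ sumTo²-*ˡ (2 ℕ.+ d) (3 ℕ.+ d) Z (term c d) ⟨
      Z * sumTo² (2 ℕ.+ d) (3 ℕ.+ d) (term c d)
        ≈⟨ *-congˡ (waringSum-pad c d 1 2) ⟩
      Z * waringSum c d
        ∎

    term-shiftₗ-zero : ∀ c d k → term (shiftₗ c) d k 0 ≈ 0#
    term-shiftₗ-zero c d k with 2 ℕ.* k ℕ.+ 3 ℕ.* 0 ≤? d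
    ... | yes _ = refl
    ... | no  _ = refl

    term-shiftₗ : ∀ c d k l → term (shiftₗ c) (suc (suc (suc d))) k (suc l) ≈ term c d k l
    term-shiftₗ c d k l with 2 ℕ.* k ℕ.+ 3 ℕ.* suc l ≤? suc (suc (suc d)) | 2 ℕ.* k ℕ.+ 3 ℕ.* l ≤? d
    ... | yes _  | yes _   rewrite residue-sucₗ d k l = refl
    ... | yes w≤ | no  w≰d = contradiction (≤-sucₗ d k l w≤) w≰d
    ... | no  w≰ | yes w≤d = contradiction (sucₗ-≤ d k l w≤d) w≰
    ... | no  _  | no  _   = refl

    waringSum-shiftₗ : ∀ c d → waringSum (shiftₗ c) (3 ℕ.+ d) ≈ waringSum c d
    waringSum-shiftₗ c d = begin
      waringSum (shiftₗ c) (3 ℕ.+ d)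
        ≈⟨ sumTo²-dropColumn (4 ℕ.+ d) (3 ℕ.+ d) _ (term-shiftₗ-zero c (3 ℕ.+ d)) ⟩
      sumTo² (4 ℕ.+ d) (3 ℕ.+ d) (λ k l → term (shiftₗ c) (3 ℕ.+ d) k (suc l))
        ≈⟨ sumTo²-cong (4 ℕ.+ d) (3 ℕ.+ d) (term-shiftₗ c d) ⟩
      sumTo² (4 ℕ.+ d) (3 ℕ.+ d) (term c d)
        ≈⟨ waringSum-pad c d 3 2 ⟩
      waringSum c d
        ∎

    term-pascal : ∀ {w c} → PascalFrom w c → ∀ {d} → w ℕ.≤ d → ∀ k l →
      term c d k l ≈ term (shiftₐ c) d k l + term (shiftₖ c) d k l + term (shiftₗ c) d k l
    term-pascal {w} {c} pascal {d} w≤d k l with 2 ℕ.* k ℕ.+ 3 ℕ.* l ≤? d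
    ... | yes kl≤d = begin
      nat· F (c a k l) v                       ≡⟨ ≡.cong (λ n → nat· F n v) split ⟩
      nat· F (cₐ ℕ.+ cₖ ℕ.+ cₗ) v              ≈⟨ nat·-+ (cₐ ℕ.+ cₖ) cₗ v ⟩
      nat· F (cₐ ℕ.+ cₖ) v + nat· F cₗ v       ≈⟨ +-congʳ (nat·-+ cₐ cₖ v) ⟩
      nat· F cₐ v + nat· F cₖ v + nat· F cₗ v  ∎
      where
      a = d ∸ 2 ℕ.* k ∸ 3 ℕ.* l
      v = pow F Z k * pow F Y a
      cₐ = shiftₐ c a k l; cₖ = shiftₖ c a k l; cₗ = shiftₗ c a k l
      split = pascal a k l (≡.subst (w ℕ.≤_) (residue-split d k l kl≤d) w≤d)
    ... | no  _ = sym (trans (+-identityʳ _) (+-identityʳ _))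

    waringSum-pascal : ∀ {w c} → PascalFrom w c → ∀ {d} → w ℕ.≤ d →
      waringSum c d ≈ waringSum (shiftₐ c) d + waringSum (shiftₖ c) d + waringSum (shiftₗ c) d
    waringSum-pascal {c = c} pascal {d} w≤d = begin
      waringSum c d
        ≈⟨ sumTo²-cong (suc d) (suc d) (term-pascal pascal w≤d) ⟩
      sumTo² (suc d) (suc d) (λ k l → tₐ k l + tₖ k l + tₗ k l)
        ≈⟨ sumTo²-+ (suc d) (suc d) _ tₗ ⟩
      sumTo² (suc d) (suc d) (λ k l → tₐ k l + tₖ k l) + waringSum (shiftₗ c) d
        ≈⟨ +-congʳ (sumTo²-+ (suc d) (suc d) tₐ tₖ) ⟩
      waringSum (shiftₐ c) d + waringSum (shiftₖ c) d + waringSum (shiftₗ c) d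
        ∎
      where tₐ = term (shiftₐ c) d; tₖ = term (shiftₖ c) d; tₗ = term (shiftₗ c) d

    waringSum-rec : ∀ {w c} → PascalFrom w c → ∀ d → w ℕ.≤ 3 ℕ.+ d →
      waringSum c (3 ℕ.+ d) ≈ Y * waringSum c (2 ℕ.+ d) + Z * waringSum c (1 ℕ.+ d) + waringSum c d
    waringSum-rec {c = c} pascal d w≤ = trans (waringSum-pascal pascal w≤)
      (+-cong (+-cong (waringSum-shiftₐ c (2 ℕ.+ d)) (waringSum-shiftₖ c (1 ℕ.+ d))) (waringSum-shiftₗ c d))

  open WaringSum

  -- waringSum transcribed into the solver's syntax: in a fixed degree both unfold to the same
  -- closed polynomial in Y and Z, so the solver can evaluate the low-degree sums.
  module WaringSumSyntax where
    powᴾ : Polynomial 2 → ℕ → Polynomial 2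
    powᴾ x zero    = con 1
    powᴾ x (suc k) = x :* powᴾ x k

    nat·ᴾ : ℕ → Polynomial 2 → Polynomial 2
    nat·ᴾ zero    x = con 0
    nat·ᴾ (suc n) x = x :+ nat·ᴾ n x

    sumToᴾ : ℕ → (ℕ → Polynomial 2) → Polynomial 2
    sumToᴾ zero    f = con 0
    sumToᴾ (suc n) f = f n :+ sumToᴾ n f

    termᴾ : Polynomial 2 → Polynomial 2 → Coeffs → ℕ → ℕ → ℕ → Polynomial 2
    termᴾ y z c d k l with 2 ℕ.* k ℕ.+ 3 ℕ.* l ≤? d
    ... | yes _ = nat·ᴾ (c (d ∸ 2 ℕ.* k ∸ 3 ℕ.* l) k l)
                        (powᴾ z k :* powᴾ y (d ∸ 2 ℕ.* k ∸ 3 ℕ.* l))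
    ... | no  _ = con 0

    waringSumᴾ : Polynomial 2 → Polynomial 2 → Coeffs → ℕ → Polynomial 2
    waringSumᴾ y z c d = sumToᴾ (suc d) (λ k → sumToᴾ (suc d) (termᴾ y z c d k))

  open WaringSumSyntax

  waringSum-1 : ∀ Y Z → waringSum Y Z waringCoeff 1 ≈ Y
  waringSum-1 = solve 2 (λ y z → waringSumᴾ y z waringCoeff 1 := y) refl

  waringSum-2 : ∀ Y Z → waringSum Y Z waringCoeff 2 ≈ Y * Y + Z * (1# + 1#)
  waringSum-2 = solve 2 (λ y z → waringSumᴾ y z waringCoeff 2 := y :* y :+ z :* (con 1 :+ con 1)) refl

  waringSum-3 : ∀ Y Z → waringSum Y Z waringCoeff 3 ≈ Y * Y * Y + (1# + 1# + 1#) + Z * (Y + Y + Y)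
  waringSum-3 = solve 2
    (λ y z → waringSumᴾ y z waringCoeff 3 := y :* y :* y :+ (con 1 :+ con 1 :+ con 1) :+ z :* (y :+ y :+ y))
    refl

  Recurrence : Carrier → Carrier → (ℕ → Carrier) → Set ℓ
  Recurrence Y Z s = ∀ d → s (4 ℕ.+ d) ≈ Y * s (3 ℕ.+ d) + Z * s (2 ℕ.+ d) + s (1 ℕ.+ d)

  recurrence-unique : ∀ {Y Z s t} → Recurrence Y Z s → Recurrence Y Z t →
    s 1 ≈ t 1 → s 2 ≈ t 2 → s 3 ≈ t 3 → ∀ d → s (suc d) ≈ t (suc d)
  recurrence-unique {Y} {Z} {s} {t} rec-s rec-t s₁≈t₁ s₂≈t₂ s₃≈t₃ = agree
    where
    agree : ∀ d → s (suc d) ≈ t (suc d)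
    agree 0 = s₁≈t₁
    agree 1 = s₂≈t₂
    agree 2 = s₃≈t₃
    agree (suc (suc (suc d))) = begin
      s (4 ℕ.+ d)                                      ≈⟨ rec-s d ⟩
      Y * s (3 ℕ.+ d) + Z * s (2 ℕ.+ d) + s (1 ℕ.+ d)  ≈⟨ +-cong (+-cong (*-congˡ (agree (suc (suc d))))
                                                                         (*-congˡ (agree (suc d))))
                                                                 (agree d) ⟩
      Y * t (3 ℕ.+ d) + Z * t (2 ℕ.+ d) + t (1 ℕ.+ d)  ≈⟨ rec-t d ⟨
      t (4 ℕ.+ d)                                      ∎

  waringSum-recurrence : ∀ Y Z → Recurrence Y Z (waringSum Y Z waringCoeff)
  waringSum-recurrence Y Z d = waringSum-rec Y Z waringCoeff-pascal (suc d) (s≤s (s≤s (s≤s (s≤s z≤n))))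

  -- Power sums

  solve-for : ∀ {Z e} → Z + e ≈ 0# → ∀ {a b c} → a + e * b ≈ c → a ≈ c + Z * b
  solve-for {Z} {e} Z+e≈0 {a} {b} {c} a+eb≈c = begin
    a                  ≈⟨ +-identityʳ a ⟨
    a + 0#             ≈⟨ +-congˡ (trans (*-congʳ Z+e≈0) (zeroˡ b)) ⟨
    a + (Z + e) * b    ≈⟨ solve 4 (λ a b z e → a :+ (z :+ e) :* b := a :+ e :* b :+ z :* b) refl a b Z e ⟩
    a + e * b + Z * b  ≈⟨ +-congʳ a+eb≈c ⟩
    c + Z * b          ∎

  module PowerSums (y₁ y₂ y₃ : Carrier) where
    e₁ e₂ e₃ : Carrier
    e₁ = y₁ + y₂ + y₃
    e₂ = y₂ * y₃ + y₁ * y₃ + y₁ * y₂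
    e₃ = y₁ * y₂ * y₃

    powerSum : ℕ → Carrier
    powerSum d = pow F y₁ d + pow F y₂ d + pow F y₃ d

    newton : ∀ d →
      powerSum (3 ℕ.+ d) + e₂ * powerSum (1 ℕ.+ d) ≈ e₁ * powerSum (2 ℕ.+ d) + e₃ * powerSum d
    newton d = solve 6
      (λ a b c u v w →
        (a :* (a :* (a :* u)) :+ b :* (b :* (b :* v)) :+ c :* (c :* (c :* w)))
          :+ (b :* c :+ a :* c :+ a :* b) :* (a :* u :+ b :* v :+ c :* w)
        := (a :+ b :+ c) :* (a :* (a :* u) :+ b :* (b :* v) :+ c :* (c :* w))
          :+ (a :* b :* c) :* (u :+ v :+ w))
      refl y₁ y₂ y₃ (pow F y₁ d) (pow F y₂ d) (pow F y₃ d)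

    newton₁ : powerSum 1 ≈ e₁
    newton₁ = solve 3 (λ a b c → a :* con 1 :+ b :* con 1 :+ c :* con 1 := a :+ b :+ c) refl y₁ y₂ y₃

    newton₂ : powerSum 2 + e₂ * (1# + 1#) ≈ e₁ * e₁
    newton₂ = solve 3
      (λ a b c → a :* (a :* con 1) :+ b :* (b :* con 1) :+ c :* (c :* con 1)
          :+ (b :* c :+ a :* c :+ a :* b) :* (con 1 :+ con 1)
        := (a :+ b :+ c) :* (a :+ b :+ c))
      refl y₁ y₂ y₃

    newton₃ : powerSum 3 + e₂ * (e₁ + e₁ + e₁) ≈ e₁ * e₁ * e₁ + e₃ * (1# + 1# + 1#)
    newton₃ = solve 3
      (λ a b c → a :* (a :* (a :* con 1)) :+ b :* (b :* (b :* con 1)) :+ c :* (c :* (c :* con 1))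
          :+ (b :* c :+ a :* c :+ a :* b) :* ((a :+ b :+ c) :+ (a :+ b :+ c) :+ (a :+ b :+ c))
        := (a :+ b :+ c) :* (a :+ b :+ c) :* (a :+ b :+ c) :+ (a :* b :* c) :* (con 1 :+ con 1 :+ con 1))
      refl y₁ y₂ y₃

    module _ {Z} (Z+e₂≈0 : Z + e₂ ≈ 0#) (e₃≈1 : e₃ ≈ 1#) where

      e₃*x≈x : ∀ x → e₃ * x ≈ x
      e₃*x≈x x = trans (*-congʳ e₃≈1) (*-identityˡ x)

      powerSum-recurrence : Recurrence e₁ Z powerSum
      powerSum-recurrence d = begin
        powerSum (4 ℕ.+ d)                         ≈⟨ solve-for Z+e₂≈0 (newton (suc d)) ⟩
        e₁ * p₃ + e₃ * p₁ + Z * p₂                 ≈⟨ +-congʳ (+-congˡ (e₃*x≈x p₁)) ⟩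
        e₁ * p₃ + p₁ + Z * p₂                      ≈⟨ +-CS.xy∙z≈xz∙y (e₁ * p₃) p₁ (Z * p₂) ⟩
        e₁ * p₃ + Z * p₂ + p₁                      ∎
        where p₁ = powerSum (1 ℕ.+ d); p₂ = powerSum (2 ℕ.+ d); p₃ = powerSum (3 ℕ.+ d)

      powerSum-2 : powerSum 2 ≈ e₁ * e₁ + Z * (1# + 1#)
      powerSum-2 = solve-for Z+e₂≈0 newton₂

      powerSum-3 : powerSum 3 ≈ e₁ * e₁ * e₁ + (1# + 1# + 1#) + Z * (e₁ + e₁ + e₁)
      powerSum-3 = trans (solve-for Z+e₂≈0 newton₃) (+-congʳ (+-congˡ (e₃*x≈x _)))

      powerSum≈waringSum : ∀ d → powerSum (suc d) ≈ waringSum e₁ Z waringCoeff (suc d)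
      powerSum≈waringSum = recurrence-unique {s = powerSum} {t = waringSum e₁ Z waringCoeff}
        powerSum-recurrence (waringSum-recurrence e₁ Z)
        (trans newton₁ (sym (waringSum-1 e₁ Z)))
        (trans powerSum-2 (sym (waringSum-2 e₁ Z)))
        (trans powerSum-3 (sym (waringSum-3 e₁ Z)))

  inverse-unique : ∀ {x y z} → x * y ≈ 1# → y * z ≈ 1# → x ≈ z
  inverse-unique {x} {y} {z} xy≈1 yz≈1 = begin
    x            ≈⟨ *-identityʳ x ⟨
    x * 1#       ≈⟨ *-congˡ yz≈1 ⟨
    x * (y * z)  ≈⟨ *-assoc x y z ⟨
    x * y * z    ≈⟨ *-congʳ xy≈1 ⟩
    1# * z       ≈⟨ *-identityˡ z ⟩
    z            ∎

  module Reciprocals {x₁ x₂ x₃ y₁ y₂ y₃ : Carrier}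
    (x₁y₁≈1 : x₁ * y₁ ≈ 1#) (x₂y₂≈1 : x₂ * y₂ ≈ 1#) (x₃y₃≈1 : x₃ * y₃ ≈ 1#)
    (x₁x₂x₃≈1 : x₁ * x₂ * x₃ ≈ 1#) where
    open PowerSums y₁ y₂ y₃

    e₃≈1 : e₃ ≈ 1#
    e₃≈1 = begin
      y₁ * y₂ * y₃                     ≈⟨ trans (*-congˡ x₁x₂x₃≈1) (*-identityʳ _) ⟨
      y₁ * y₂ * y₃ * (x₁ * x₂ * x₃)    ≈⟨ solve 6 (λ a b c u v w → a :* b :* c :* (u :* v :* w)
                                                   := u :* a :* (v :* b) :* (w :* c))
                                                 refl y₁ y₂ y₃ x₁ x₂ x₃ ⟩
      x₁ * y₁ * (x₂ * y₂) * (x₃ * y₃)  ≈⟨ *-cong (*-cong x₁y₁≈1 x₂y₂≈1) x₃y₃≈1 ⟩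
      1# * 1# * 1#                     ≈⟨ trans (*-identityʳ _) (*-identityʳ 1#) ⟩
      1#                               ∎

    -X+e₂≈0 : - (x₁ + x₂ + x₃) + e₂ ≈ 0#
    -X+e₂≈0 = trans (+-congˡ (sym (+-cong (+-cong x₁≈y₂y₃ x₂≈y₁y₃) x₃≈y₁y₂))) (-‿inverseˡ _)
      where
      y₁[y₂y₃]≈1 = trans (sym (*-assoc y₁ y₂ y₃)) e₃≈1
      x₁≈y₂y₃ = inverse-unique x₁y₁≈1 y₁[y₂y₃]≈1
      x₂≈y₁y₃ = inverse-unique x₂y₂≈1 (trans (*-CS.x∙yz≈y∙xz y₂ y₁ y₃) y₁[y₂y₃]≈1)
      x₃≈y₁y₂ = inverse-unique x₃y₃≈1 (trans (*-comm y₃ (y₁ * y₂)) e₃≈1)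

  -- Signs and the polynomial P_d

  sgn·-cong : ∀ k {u v} → u ≈ v → sgn· F k u ≈ sgn· F k v
  sgn·-cong zero          u≈v = -‿cong u≈v
  sgn·-cong (suc zero)    u≈v = u≈v
  sgn·-cong (suc (suc k)) u≈v = sgn·-cong k u≈v

  -x*-x≈x*x : ∀ x → - x * - x ≈ x * x
  -x*-x≈x*x x = begin
    - x * - x    ≈⟨ -‿distribˡ-* x (- x) ⟨
    - (x * - x)  ≈⟨ -‿cong (-‿distribʳ-* x x) ⟨
    - - (x * x)  ≈⟨ -‿involutive (x * x) ⟩
    x * x        ∎

  sgn·-pow : ∀ k x w → sgn· F k (pow F x k * w) ≈ - (pow F (- x) k * w)
  sgn·-pow zero          x w = refl
  sgn·-pow (suc zero)    x w = begin
    x * 1# * w          ≈⟨ -‿involutive _ ⟨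
    - - (x * 1# * w)    ≈⟨ -‿cong (-‿distribˡ-* (x * 1#) w) ⟩
    - (- (x * 1#) * w)  ≈⟨ -‿cong (*-congʳ (-‿distribˡ-* x 1#)) ⟩
    - (- x * 1# * w)    ∎
  sgn·-pow (suc (suc k)) x w = begin
    sgn· F k (x * (x * pow F x k) * w)   ≈⟨ sgn·-cong k (rearrange x x (pow F x k) w) ⟩
    sgn· F k (pow F x k * (x * x * w))   ≈⟨ sgn·-pow k x (x * x * w) ⟩
    - (pow F (- x) k * (x * x * w))      ≈⟨ -‿cong (*-congˡ (*-congʳ (-x*-x≈x*x x))) ⟨
    - (pow F (- x) k * (- x * - x * w))  ≈⟨ -‿cong (rearrange (- x) (- x) (pow F (- x) k) w) ⟨
    - (- x * (- x * pow F (- x) k) * w)  ∎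
    where
    rearrange : ∀ a b p w → a * (b * p) * w ≈ p * (a * b * w)
    rearrange = solve 4 (λ a b p w → a :* (b :* p) :* w := p :* (a :* b :* w)) refl

  module _ (X Y : Carrier) where

    neg-term≈Pterm : ∀ d → 1 ℕ.≤ d → ∀ k l → - term Y (- X) waringCoeff d k l ≈ Pterm F d X Y k l
    neg-term≈Pterm d 1≤d k l with 2 ℕ.* k ℕ.+ 3 ℕ.* l ≤? d
    ... | no  _    = -0#≈0#
    ... | yes kl≤d with d ∸ k ∸ 2 ℕ.* l in size≡
    ...   | zero  = contradiction (≡.subst (1 ℕ.≤_) d≡0 1≤d) λ ()
      where
      a = d ∸ 2 ℕ.* k ∸ 3 ℕ.* l
      d≡ = residue-split d k l kl≤d
      d≡0 = ≡.trans d≡ (size-zero⇒weight-zero a k l (≡.trans (≡.sym (residue-k+l d a k l d≡)) size≡))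
    ...   | suc m = begin
      - nat· F n (pow F (- X) k * v)       ≈⟨ -‿cong (nat·-*ˡ n (pow F (- X) k) v) ⟩
      - (pow F (- X) k * nat· F n v)       ≈⟨ sgn·-pow k X (nat· F n v) ⟨
      sgn· F k (pow F X k * nat· F n v)    ≈⟨ sgn·-cong k (nat·-*ˡ n (pow F X k) v) ⟨
      sgn· F k (nat· F n (pow F X k * v))  ≡⟨ ≡.cong (λ n → sgn· F k (nat· F n (pow F X k * v)))
                                                      coefficient ⟨
      sgn· F k (nat· F (d ℕ.* ((k ℕ.+ l) C k) ℕ.* (suc m C (k ℕ.+ l)) / suc m) (pow F X k * v)) ∎
      where
      a = d ∸ 2 ℕ.* k ∸ 3 ℕ.* l
      v = pow F Y a
      n = waringCoeff a k l
      d≡ = residue-split d k l kl≤d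
      coefficient = waringCoeff-quotient d a k l m d≡ (≡.trans (≡.sym size≡) (residue-k+l d a k l d≡))

    neg-waringSum≈P : ∀ d → 1 ℕ.≤ d → - waringSum Y (- X) waringCoeff d ≈ P F d X Y
    neg-waringSum≈P d 1≤d =
      trans (sumTo²-neg (suc d) (suc d) _) (sumTo²-cong (suc d) (suc d) (neg-term≈Pterm d 1≤d))

-- The reciprocals yᵢ are supplied.
corollary1 : {c ℓ : Level} (F : CommutativeRing c ℓ) → IsField F →
    let open CommutativeRing F in
    (x₁ x₂ x₃ y₁ y₂ y₃ : Carrier) →
    ¬ (x₁ ≈ 0#) → ¬ (x₂ ≈ 0#) → ¬ (x₃ ≈ 0#) →
    x₁ * y₁ ≈ 1# → x₂ * y₂ ≈ 1# → x₃ * y₃ ≈ 1# →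
    x₁ * x₂ * x₃ ≈ 1# →
    (d : ℕ) → d ≥ 1 →
    - (pow F y₁ d + pow F y₂ d + pow F y₃ d) ≈ P F d (x₁ + x₂ + x₃) (y₁ + y₂ + y₃)
corollary1 F _ x₁ x₂ x₃ y₁ y₂ y₃ _ _ _ x₁y₁≈1 x₂y₂≈1 x₃y₃≈1 x₁x₂x₃≈1 (suc d) _ = begin
  - powerSum (suc d)                        ≈⟨ -‿cong (powerSum≈waringSum -X+e₂≈0 e₃≈1 d) ⟩
  - waringSum e₁ (- X) waringCoeff (suc d)  ≈⟨ neg-waringSum≈P F X e₁ (suc d) (s≤s z≤n) ⟩
  P F (suc d) X e₁                          ∎
  where
  open CommutativeRing F
  open import Relation.Binary.Reasoning.Setoid setoid
  open WaringSum F using (waringSum)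
  open PowerSums F y₁ y₂ y₃
  open Reciprocals F x₁y₁≈1 x₂y₂≈1 x₃y₃≈1 x₁x₂x₃≈1
  X = x₁ + x₂ + x₃
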